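{- For every integer $n\ge0$, let $B_n$ be the number of $n$-tilings using squares and $(1,1)$-fences, i.e. the number of tilings of boards (of any length) that use exactly $n$ tiles in total, each tile being a square or a $(1,1)$-fence. Then $B_n=J_{n+1}$, where $J_m$ is the $m$th Jacobsthal number.
   Context: A board of length $L$ is a $1\times L$ row of unit cells. A square is a $1\times1$ tile covering one cell. A $(1,1)$-fence is a tile made of two $1\times1$ posts separated by a one-cell gap; placed on a board its posts occupy cells $i$ and $i+2$, and the gap cell $i+1$ must be covered by another tile. A tiling covers every cell of the board exactly once. The empty tiling (using $0$ tiles, of the empty board) is counted, so $B_0=1$. Jacobsthal numbers: $J_0=0$, $J_1=1$, $J_m=J_{m-1}+2J_{m-2}$ for $m\ge2$. -}

module Defs where

open import Data.Nat using (ℕ; zero; suc; _+_; _*_; _<ᵇ_; _≡ᵇ_)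
open import Data.Bool using (Bool; true; false; _∧_; if_then_else_; T)
open import Data.List using (List; []; _∷_; length; map; upTo; all)
open import Data.Nat.ListAction using (sum)
open import Data.Product using (Σ; _×_)

J : ℕ → ℕ
J zero = 0
J (suc zero) = 1
J (suc (suc m)) = J (suc m) + 2 * J m

data Kind : Set where
  square : Kind
  fence  : Kind   -- (1,1)-fence: posts at i and i+2, gap at i+1

-- A tile placed on the board, with its leftmost cell at position pos
-- (cells of a board of length L are 0 .. L-1).
record Placed : Set where
  constructor place
  field
    kind : Kind
    pos  : ℕ
open Placed public

cells : Placed → List ℕ
cells (place square i) = i ∷ []
cells (place fence i)  = i ∷ (i + 2) ∷ []

countAt : List Placed → ℕ → ℕ
countAt ps c = sum (map (λ p → sum (map (λ d → if d ≡ᵇ c then 1 else 0) (cells p))) ps)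

-- placements listed with strictly increasing left positions
-- (canonical representative of the finite set of placed tiles)
increasing : List Placed → Bool
increasing [] = true
increasing (p ∷ []) = true
increasing (p ∷ q ∷ ps) = (pos p <ᵇ pos q) ∧ increasing (q ∷ ps)

onBoard : ℕ → List Placed → Bool
onBoard L ps = all (λ p → all (λ d → d <ᵇ L) (cells p)) ps

exactCover : ℕ → List Placed → Bool
exactCover L ps = all (λ c → countAt ps c ≡ᵇ 1) (upTo L)

isTiling : ℕ → List Placed → Bool
isTiling L ps = increasing ps ∧ onBoard L ps ∧ exactCover L ps

NTiling : ℕ → Set
NTiling n = Σ ℕ (λ L → Σ (List Placed) (λ ps → T (isTiling L ps) × T (length ps ≡ᵇ n)))

-- Read from left to right, every tiling by squares and (1,1)-fences splits uniquely into
-- blocks: a lone square (one tile, width 1), a fence whose gap holds a square (two tiles,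
-- width 3), or two interleaved fences (two tiles, width 4).  Indeed the leftmost tile must
-- sit on the leftmost cell; if it is a fence, the tile covering its gap must start at the
-- gap, and if that tile is a second fence, its own gap is the far post of the first.
-- So n-tilings correspond to words in one 1-tile block and two 2-tile blocks with n tiles
-- in total, whose number satisfies the Jacobsthal recurrence B (n + 2) = B (n + 1) + 2 B n.

module Submission where

open import Defs
open import Data.Nat using (ℕ; zero; suc; _+_; _≡ᵇ_; _≤_; _<_; z≤n; z<s)
open import Data.Nat.Properties
open import Data.Nat.ListAction using (sum)
open import Data.Bool using (true; false; if_then_else_; T)
open import Data.Bool.Properties using (T-∧; T-irrelevant)
open import Data.List using (List; []; _∷_; _++_; length; map)
open import Data.List.Properties using (length-map; ++-cancelˡ; map-injective)
open import Data.List.Relation.Unary.All as All using (All; []; _∷_)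
open import Data.List.Relation.Unary.All.Properties using (all⁺; all⁻; applyUpTo⁺₁; applyUpTo⁻)
import Data.List.Relation.Unary.All.Properties as All
open import Data.List.Relation.Unary.AllPairs as AllPairs using (AllPairs; []; _∷_)
import Data.List.Relation.Unary.AllPairs.Properties as AllPairs
open import Data.List.Relation.Unary.Linked using (Linked; []; [-]; _∷_)
open import Data.List.Relation.Unary.Linked.Properties using (Linked⇒AllPairs; AllPairs⇒Linked)
open import Data.Product using (Σ-syntax; ∃; _×_; _,_; proj₁; proj₂)
open import Data.Sum using (_⊎_; inj₁; inj₂)
open import Data.Fin using (Fin; zero; suc)
open import Data.Fin.Properties using (+↔⊎; *↔×)
open import Data.Product.Function.NonDependent.Propositional using (_×-↔_)
open import Data.Sum.Function.Propositional using (_⊎-↔_)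
open import Function using (_∘_; id)
open import Function.Bundles using (_↔_; _⇔_; mk↔ₛ′; mk⇔; Equivalence)
open import Function.Properties.Inverse using (↔-trans)
open import Relation.Nullary using (yes; no; contradiction)
open import Relation.Binary.PropositionalEquality hiding (J)

private
  variable
    c d k n L : ℕ
    ps qs ts : List Placed

indicator : ℕ → ℕ → ℕ
indicator d c = if d ≡ᵇ c then 1 else 0

hits : Placed → ℕ → ℕ
hits p c = sum (map (λ d → indicator d c) (cells p))

indicator-refl : ∀ d → indicator d d ≡ 1
indicator-refl zero    = refl
indicator-refl (suc d) = indicator-refl d

indicator-≢ : d ≢ c → indicator d c ≡ 0
indicator-≢ {d} {c} d≢c with d ≡ᵇ c | ≡ᵇ⇒≡ d c
... | false | _   = refl
... | true  | d≡c = contradiction (d≡c _) d≢c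

countAt-++ : ∀ ts → countAt (ts ++ ps) c ≡ countAt ts c + countAt ps c
countAt-++ []       = refl
countAt-++ (p ∷ ts) = trans (cong (hits p _ +_) (countAt-++ ts)) (sym (+-assoc (hits p _) _ _))

countAt-missing : All (λ p → All (_≢ c) (cells p)) ps → countAt ps c ≡ 0
countAt-missing []           = refl
countAt-missing (p∌c ∷ ps∌c) = cong₂ _+_ (indicators-missing p∌c) (countAt-missing ps∌c)
  where
  indicators-missing : ∀ {ds} → All (_≢ c) ds → sum (map (λ d → indicator d c) ds) ≡ 0
  indicators-missing []           = refl
  indicators-missing (d≢c ∷ ds≢c) = cong₂ _+_ (indicator-≢ d≢c) (indicators-missing ds≢c)

pos-within : ∀ p → All (_< L) (cells p) → pos p < L
pos-within (place square _) (i<L ∷ _) = i<L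
pos-within (place fence  _) (i<L ∷ _) = i<L

pos≤cells : ∀ p → All (pos p ≤_) (cells p)
pos≤cells (place square i) = ≤-refl ∷ []
pos≤cells (place fence  i) = ≤-refl ∷ m≤m+n i 2 ∷ []

hits-pos : ∀ p → hits p (pos p) ≢ 0
hits-pos (place square i) e = 1+n≢0 (trans (sym (indicator-refl i)) (m+n≡0⇒m≡0 _ e))
hits-pos (place fence  i) e = 1+n≢0 (trans (sym (indicator-refl i)) (m+n≡0⇒m≡0 _ e))

countAt-below : All (λ p → c < pos p) ps → countAt ps c ≡ 0
countAt-below = countAt-missing ∘ All.map λ {p} c<p →
  All.map (λ p≤d → >⇒≢ (<-≤-trans c<p p≤d)) (pos≤cells p)

countAt≡0⇒above : All (λ p → c ≤ pos p) ps → countAt ps c ≡ 0 →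
                  All (λ p → suc c ≤ pos p) ps
countAt≡0⇒above []           _ = []
countAt≡0⇒above {ps = p ∷ _} (c≤p ∷ c≤ps) e =
  ≤∧≢⇒< c≤p (λ { refl → hits-pos p (m+n≡0⇒m≡0 _ e) }) ∷ countAt≡0⇒above c≤ps (m+n≡0⇒n≡0 _ e)

leftmost : ∀ p → c ≤ pos p → All (λ q → pos p < pos q) ps → countAt (p ∷ ps) c ≡ 1 →
           pos p ≡ c
leftmost {ps = ps} p c≤p p<ps covered with m≤n⇒m<n∨m≡n c≤p
... | inj₂ c≡p = sym c≡p
... | inj₁ c<p = contradiction (trans (sym covered) uncovered) 1+n≢0
  where
  uncovered : countAt (p ∷ ps) _ ≡ 0
  uncovered = countAt-below {ps = p ∷ ps} (c<p ∷ All.map (<-trans c<p) p<ps)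

shiftPlaced : ℕ → Placed → Placed
shiftPlaced k p = place (kind p) (k + pos p)

shift : ℕ → List Placed → List Placed
shift k = map (shiftPlaced k)

shiftPlaced-injective : ∀ {p q} → shiftPlaced k p ≡ shiftPlaced k q → p ≡ q
shiftPlaced-injective {k} e = cong₂ place (cong kind e) (+-cancelˡ-≡ k _ _ (cong pos e))

cells-shift : ∀ k p → cells (shiftPlaced k p) ≡ map (k +_) (cells p)
cells-shift k (place square i) = refl
cells-shift k (place fence  i) = cong (λ x → k + i ∷ x ∷ []) (+-assoc k i 2)

shift-within : ∀ k p → All (_< L) (cells p) → All (_< k + L) (cells (shiftPlaced k p))
shift-within k p p∈ rewrite cells-shift k p = All.map⁺ (All.map (+-monoʳ-< k) p∈)

unshift-within : ∀ k p → All (_< k + L) (cells (shiftPlaced k p)) → All (_< L) (cells p)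
unshift-within k p p∈ rewrite cells-shift k p = All.map (+-cancelˡ-< k _ _) (All.map⁻ p∈)

shift-above : ∀ k ps → All (λ p → k ≤ pos p) (shift k ps)
shift-above k []       = []
shift-above k (p ∷ ps) = m≤m+n k (pos p) ∷ shift-above k ps

hits-shift : ∀ k p c → hits (shiftPlaced k p) (k + c) ≡ hits p c
hits-shift zero    p                c = refl
hits-shift (suc k) (place square i) c = hits-shift k (place square i) c
hits-shift (suc k) (place fence  i) c = hits-shift k (place fence i) c

countAt-shift : ∀ k ps c → countAt (shift k ps) (k + c) ≡ countAt ps c
countAt-shift k []       c = refl
countAt-shift k (p ∷ ps) c = cong₂ _+_ (hits-shift k p c) (countAt-shift k ps c)

unshift : All (λ p → k ≤ pos p) ps → ∃ λ qs → ps ≡ shift k qs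
unshift [] = [] , refl
unshift {ps = place κ i ∷ _} (k≤i ∷ k≤ps) with m≤n⇒∃[o]m+o≡n k≤i | unshift k≤ps
... | j , refl | qs , refl = place κ j ∷ qs , refl

_<ₚ_ : Placed → Placed → Set
p <ₚ q = pos p < pos q

record Tiling (L : ℕ) (ps : List Placed) : Set where
  field
    sorted : AllPairs _<ₚ_ ps
    within : All (All (_< L) ∘ cells) ps
    exact  : c < L → countAt ps c ≡ 1
open Tiling

isTiling⇔Tiling : T (isTiling L ps) ⇔ Tiling L ps
isTiling⇔Tiling {L} {ps} = mk⇔ to from
  where
  increasing⇒Linked : ∀ ps → T (increasing ps) → Linked _<ₚ_ ps
  increasing⇒Linked []           _ = []
  increasing⇒Linked (_ ∷ [])     _ = [-]
  increasing⇒Linked (p ∷ q ∷ ps) t =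
    let p<q , t′ = Equivalence.to T-∧ t in <ᵇ⇒< _ _ p<q ∷ increasing⇒Linked (q ∷ ps) t′

  Linked⇒increasing : ∀ {ps} → Linked _<ₚ_ ps → T (increasing ps)
  Linked⇒increasing []          = _
  Linked⇒increasing [-]         = _
  Linked⇒increasing (p<q ∷ p<s) = Equivalence.from T-∧ (<⇒<ᵇ p<q , Linked⇒increasing p<s)

  to : T (isTiling L ps) → Tiling L ps
  to t = let inc , t′ = Equivalence.to T-∧ t ; board , cover = Equivalence.to T-∧ t′ in record
    { sorted = Linked⇒AllPairs <-trans (increasing⇒Linked ps inc)
    ; within = All.map (λ {p} → All.map (<ᵇ⇒< _ _) ∘ all⁺ _ (cells p)) (all⁺ _ ps board)
    ; exact  = λ c<L → ≡ᵇ⇒≡ _ _ (applyUpTo⁻ id L (all⁺ _ _ cover) c<L)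
    }

  from : Tiling L ps → T (isTiling L ps)
  from t = Equivalence.from T-∧ (Linked⇒increasing (AllPairs⇒Linked (sorted t)) ,
    Equivalence.from T-∧ (all⁻ _ (All.map (all⁻ _ ∘ All.map <⇒<ᵇ) (within t)) ,
      all⁻ _ (applyUpTo⁺₁ id L (λ c<L → ≡⇒≡ᵇ _ _ (exact t c<L)))))

tiling-[] : Tiling L [] → L ≡ 0
tiling-[] {zero}  _ = refl
tiling-[] {suc L} t with exact t z<s
... | ()

countAt-++-shiftˡ : c < k → ∀ ts → countAt (ts ++ shift k ps) c ≡ countAt ts c
countAt-++-shiftˡ {c} {k} {ps} c<k ts = begin
  countAt (ts ++ shift k ps) c          ≡⟨ countAt-++ ts ⟩
  countAt ts c + countAt (shift k ps) c ≡⟨ cong (countAt ts c +_) (countAt-below shift>c) ⟩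
  countAt ts c + 0                      ≡⟨ +-identityʳ _ ⟩
  countAt ts c                          ∎
  where
  open ≡-Reasoning
  shift>c = All.map (<-≤-trans c<k) (shift-above k ps)

countAt-++-shiftʳ : All (All (_< k) ∘ cells) ts →
                    countAt (ts ++ shift k ps) (k + d) ≡ countAt ps d
countAt-++-shiftʳ {k} {ts} {ps} {d} ts<k = begin
  countAt (ts ++ shift k ps) (k + d)                ≡⟨ countAt-++ ts ⟩
  countAt ts (k + d) + countAt (shift k ps) (k + d) ≡⟨ cong₂ _+_ ts∌k+d (countAt-shift k ps d) ⟩
  countAt ps d                                      ∎
  where
  open ≡-Reasoning
  ts∌k+d = countAt-missing (All.map (All.map λ c<k → <⇒≢ (<-≤-trans c<k (m≤m+n k d))) ts<k)

tiling-++ : Tiling k ts → Tiling L ps → Tiling (k + L) (ts ++ shift k ps)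
tiling-++ {k} {ts} {L} {ps} t u = record
  { sorted = AllPairs.++⁺ (sorted t) (AllPairs.map⁺ (AllPairs.map (+-monoʳ-< k) (sorted u)))
                          (All.map ts<shift (within t))
  ; within = All.++⁺ (All.map (All.map λ c<k → <-≤-trans c<k (m≤m+n k L)) (within t))
                     (All.map⁺ (All.map (shift-within k _) (within u)))
  ; exact  = exact′
  }
  where
  ts<shift : ∀ {p} → All (_< k) (cells p) → All (p <ₚ_) (shift k ps)
  ts<shift {p} p∈ = All.map (<-≤-trans (pos-within p p∈)) (shift-above k ps)

  exact′ : c < k + L → countAt (ts ++ shift k ps) c ≡ 1
  exact′ {c} c<k+L with c <? k
  ... | yes c<k = trans (countAt-++-shiftˡ c<k ts) (exact t c<k)
  ... | no  c≮k with m≤n⇒∃[o]m+o≡n (≮⇒≥ c≮k)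
  ...   | d , refl = trans (countAt-++-shiftʳ (within t)) (exact u (+-cancelˡ-< k _ _ c<k+L))

tiling-++⁻ : Tiling k ts → Tiling (k + L) (ts ++ shift k ps) → Tiling L ps
tiling-++⁻ {k} {ts} t u = record
  { sorted = AllPairs.map (+-cancelˡ-< k _ _) (AllPairs.map⁻ (sorted-suffix ts (sorted u)))
  ; within = All.map (unshift-within k _) (All.map⁻ (All.++⁻ʳ ts (within u)))
  ; exact  = λ d<L → trans (sym (countAt-++-shiftʳ (within t))) (exact u (+-monoʳ-< k d<L))
  }
  where
  sorted-suffix : ∀ ts → AllPairs _<ₚ_ (ts ++ qs) → AllPairs _<ₚ_ qs
  sorted-suffix []       s       = s
  sorted-suffix (_ ∷ ts) (_ ∷ s) = sorted-suffix ts s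

data Block : ℕ → Set where
  square                 : Block 1
  fenceSquare fenceFence : Block 2

tiles : Block k → List Placed
tiles square      = place square 0 ∷ []
tiles fenceSquare = place fence 0 ∷ place square 1 ∷ []
tiles fenceFence  = place fence 0 ∷ place fence 1 ∷ []

width : Block k → ℕ
width square      = 1
width fenceSquare = 3
width fenceFence  = 4

block-tiling : (b : Block k) → Tiling (width b) (tiles b)
block-tiling square      = Equivalence.to isTiling⇔Tiling _
block-tiling fenceSquare = Equivalence.to isTiling⇔Tiling _
block-tiling fenceFence  = Equivalence.to isTiling⇔Tiling _

-- Each block is laid at cell 0 and what follows is translated, so the cover counts near
-- the block reduce by evaluation (see fenceView).
attach : Block k → List Placed → List Placed
attach b ps = tiles b ++ shift (width b) ps

length-attach : (b : Block k) (ps : List Placed) → length (attach b ps) ≡ k + length ps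
length-attach square      ps = cong suc (length-map (shiftPlaced 1) ps)
length-attach fenceSquare ps = cong (2 +_) (length-map (shiftPlaced 3) ps)
length-attach fenceFence  ps = cong (2 +_) (length-map (shiftPlaced 4) ps)

attach-injectiveʳ : (b : Block k) → attach b ps ≡ attach b qs → ps ≡ qs
attach-injectiveʳ b e = map-injective shiftPlaced-injective (++-cancelˡ (tiles b) _ _ e)

attach-injectiveˡ : (b b′ : Block 2) → attach b ps ≡ attach b′ qs → b ≡ b′
attach-injectiveˡ fenceSquare fenceSquare _ = refl
attach-injectiveˡ fenceFence  fenceFence  _ = refl
attach-injectiveˡ fenceSquare fenceFence  ()
attach-injectiveˡ fenceFence  fenceSquare ()

data TilingView : ℕ → List Placed → Set where
  empty : TilingView 0 []
  block : (b : Block k) (rest : List Placed) → Tiling L rest →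
          TilingView (width b + L) (attach b rest)

leadingBlock : (b : Block k) → width b ≤ L → All (λ q → width b ≤ pos q) ps →
               Tiling L (tiles b ++ ps) → TilingView L (tiles b ++ ps)
leadingBlock b fits above t with unshift above | m≤n⇒∃[o]m+o≡n fits
... | rest , refl | _ , refl = block b rest (tiling-++⁻ (block-tiling b) t)

-- The gap cell 1 forces the second tile to start at 1.  Cell 2 is the far post of the
-- first fence and, if the second tile is a fence, cell 3 is its far post; the remaining
-- tiles avoid these cells and so start after them.
fenceView : Tiling L (place fence 0 ∷ ps) → TilingView L (place fence 0 ∷ ps)
fenceView {ps = []} t with within t
... | (_ ∷ 2<L ∷ []) ∷ _ with exact t (<-trans (n<1+n 1) 2<L)
... | ()
fenceView {ps = q ∷ _} t with sorted t | within t
... | (0<q ∷ _) ∷ q<ps ∷ _ | (_ ∷ 2<L ∷ []) ∷ _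
    with leftmost q 0<q q<ps (exact t (<-trans (n<1+n 1) 2<L))
fenceView {ps = place square _ ∷ _} t | _ ∷ q<ps ∷ _ | (_ ∷ 2<L ∷ []) ∷ _ | refl =
  leadingBlock fenceSquare 2<L (countAt≡0⇒above q<ps (suc-injective (exact t 2<L))) t
fenceView {ps = place fence _ ∷ _} t | _ ∷ q<ps ∷ _ | _ ∷ (_ ∷ 3<L ∷ []) ∷ _ | refl =
  leadingBlock fenceFence 3<L above3 t
  where
  above2 = countAt≡0⇒above q<ps (suc-injective (exact t (<-trans (n<1+n 2) 3<L)))
  above3 = countAt≡0⇒above above2 (suc-injective (exact t 3<L))

tilingView : Tiling L ps → TilingView L ps
tilingView {ps = []} t with tiling-[] t
... | refl = empty
tilingView {ps = p ∷ _} t with sorted t | within t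
... | p<ps ∷ _ | p∈ ∷ _ with leftmost p z≤n p<ps (exact t (≤-<-trans z≤n (pos-within p p∈)))
tilingView {ps = place square _ ∷ _} t | p<ps ∷ _ | (0<L ∷ _) ∷ _ | refl =
  leadingBlock square 0<L p<ps t
tilingView {ps = place fence  _ ∷ _} t | _ | _ | refl = fenceView t

data BlockWord : ℕ → Set where
  []       : BlockWord 0
  square∷_ : BlockWord n → BlockWord (suc n)
  _∷_      : Block 2 → BlockWord n → BlockWord (suc (suc n))

layout : BlockWord n → List Placed
layout []          = []
layout (square∷ w) = attach square (layout w)
layout (b ∷ w)     = attach b (layout w)

span : BlockWord n → ℕ
span []          = 0
span (square∷ w) = width square + span w
span (b ∷ w)     = width b + span w

layout-tiling : (w : BlockWord n) → Tiling (span w) (layout w)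
layout-tiling []          = record { sorted = [] ; within = [] ; exact = λ () }
layout-tiling (square∷ w) = tiling-++ (block-tiling square) (layout-tiling w)
layout-tiling (b ∷ w)     = tiling-++ (block-tiling b) (layout-tiling w)

layout-length : (w : BlockWord n) → length (layout w) ≡ n
layout-length []          = refl
layout-length (square∷ w) = trans (length-attach square (layout w)) (cong (1 +_) (layout-length w))
layout-length (b ∷ w)     = trans (length-attach b (layout w)) (cong (2 +_) (layout-length w))

layout-injective : (w w′ : BlockWord n) → layout w ≡ layout w′ → w ≡ w′
layout-injective []          []           _ = refl
layout-injective (square∷ w) (square∷ w′) e =
  cong square∷_ (layout-injective w w′ (attach-injectiveʳ {ps = layout w} square e))
layout-injective (b ∷ w)     (b′ ∷ w′)    e with attach-injectiveˡ {ps = layout w} b b′ e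
... | refl = cong (b ∷_) (layout-injective w w′ (attach-injectiveʳ {ps = layout w} b e))
layout-injective (square∷ _)       (fenceSquare ∷ _) ()
layout-injective (square∷ _)       (fenceFence ∷ _)  ()
layout-injective (fenceSquare ∷ _) (square∷ _)       ()
layout-injective (fenceFence ∷ _)  (square∷ _)       ()

Decoding : ℕ → ℕ → List Placed → Set
Decoding n L ps = Σ[ w ∈ BlockWord n ] layout w ≡ ps × span w ≡ L

square∷-decoding : Decoding n L ps → Decoding (suc n) (width square + L) (attach square ps)
square∷-decoding (w , refl , refl) = square∷ w , refl , refl

∷-decoding : (b : Block 2) → Decoding n L ps → Decoding (suc (suc n)) (width b + L) (attach b ps)
∷-decoding b (w , refl , refl) = b ∷ w , refl , refl

length-rest : (b : Block k) (ps : List Placed) → length (attach b ps) ≡ k + n → length ps ≡ n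
length-rest {k} b ps len = +-cancelˡ-≡ k _ _ (trans (sym (length-attach b ps)) len)

-- The rest of a tiling after its first block is a translate, not a sublist, so the
-- recursion is on the number of tiles.
mutual
  decode : ∀ n → length ps ≡ n → Tiling L ps → Decoding n L ps
  decode n len t = decodeView n (tilingView t) len

  decodeView : ∀ n → TilingView L ps → length ps ≡ n → Decoding n L ps
  decodeView zero          empty                      _   = [] , refl , refl
  decodeView (suc n)       (block square rest t)      len =
    square∷-decoding (decode n (length-rest square rest len) t)
  decodeView (suc (suc n)) (block fenceSquare rest t) len =
    ∷-decoding fenceSquare (decode n (length-rest fenceSquare rest len) t)
  decodeView (suc (suc n)) (block fenceFence rest t)  len =
    ∷-decoding fenceFence (decode n (length-rest fenceFence rest len) t)
  decodeView (suc _)       empty                      ()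
  decodeView zero          (block square _ _)         ()
  decodeView zero          (block fenceSquare _ _)    ()
  decodeView zero          (block fenceFence _ _)     ()
  decodeView (suc zero)    (block fenceSquare _ _)    ()
  decodeView (suc zero)    (block fenceFence _ _)     ()

Fin2↔Block2 : Fin 2 ↔ Block 2
Fin2↔Block2 = mk↔ₛ′ (λ { zero → fenceSquare ; (suc zero) → fenceFence })
                    (λ { fenceSquare → zero ; fenceFence → suc zero })
                    (λ { fenceSquare → refl ; fenceFence → refl })
                    (λ { zero → refl ; (suc zero) → refl })

BlockWord-unfold : (BlockWord (suc n) ⊎ Block 2 × BlockWord n) ↔ BlockWord (suc (suc n))
BlockWord-unfold = mk↔ₛ′ (λ { (inj₁ w) → square∷ w ; (inj₂ (b , w)) → b ∷ w })
                         (λ { (square∷ w) → inj₁ w ; (b ∷ w) → inj₂ (b , w) })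
                         (λ { (square∷ w) → refl ; (b ∷ w) → refl })
                         (λ { (inj₁ w) → refl ; (inj₂ (b , w)) → refl })

Fin-J↔BlockWord : ∀ n → Fin (J (suc n)) ↔ BlockWord n
Fin-J↔BlockWord zero =
  mk↔ₛ′ (λ _ → []) (λ _ → zero) (λ { [] → refl }) (λ { zero → refl ; (suc ()) })
Fin-J↔BlockWord (suc zero) =
  mk↔ₛ′ (λ _ → square∷ []) (λ _ → zero) (λ { (square∷ []) → refl }) (λ { zero → refl ; (suc ()) })
Fin-J↔BlockWord (suc (suc n)) =
  ↔-trans +↔⊎
    (↔-trans (Fin-J↔BlockWord (suc n) ⊎-↔ ↔-trans *↔× (Fin2↔Block2 ×-↔ Fin-J↔BlockWord n))
             BlockWord-unfold)

BlockWord↔NTiling : ∀ n → BlockWord n ↔ NTiling n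
BlockWord↔NTiling n = mk↔ₛ′ toTiling fromTiling toTiling∘fromTiling fromTiling∘toTiling
  where
  toTiling : BlockWord n → NTiling n
  toTiling w = span w , layout w ,
               Equivalence.from isTiling⇔Tiling (layout-tiling w) , ≡⇒≡ᵇ _ _ (layout-length w)

  decodeTiling : (t : NTiling n) → Decoding n (proj₁ t) (proj₁ (proj₂ t))
  decodeTiling (_ , _ , isT , len) = decode n (≡ᵇ⇒≡ _ _ len) (Equivalence.to isTiling⇔Tiling isT)

  fromTiling : NTiling n → BlockWord n
  fromTiling t = proj₁ (decodeTiling t)

  NTiling-≡ : {t t′ : NTiling n} → proj₁ t ≡ proj₁ t′ → proj₁ (proj₂ t) ≡ proj₁ (proj₂ t′) → t ≡ t′
  NTiling-≡ {_ , _ , a , b} {_ , _ , a′ , b′} refl refl =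
    cong₂ (λ x y → _ , _ , x , y) (T-irrelevant a a′) (T-irrelevant b b′)

  toTiling∘fromTiling : ∀ t → toTiling (fromTiling t) ≡ t
  toTiling∘fromTiling t = let _ , e , s = decodeTiling t in NTiling-≡ s e

  fromTiling∘toTiling : ∀ w → fromTiling (toTiling w) ≡ w
  fromTiling∘toTiling w = layout-injective _ w (proj₁ (proj₂ (decodeTiling (toTiling w))))

theorem2p5 : (n : ℕ) → Fin (J (suc n)) ↔ NTiling n
theorem2p5 n = ↔-trans (Fin-J↔BlockWord n) (BlockWord↔NTiling n)
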